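{- Let $m\ge 1$. For every integer $n\ge 0$, $$\sum_{k=0}^{mn}\binom{n}{k}_m^2=\binom{2n}{mn}_m,\qquad \sum_{k=0}^{mn}k\binom{n}{k}_m^2=\frac{mn}{2}\binom{2n}{mn}_m,$$ $$\sum_{k=0}^{mn}k^2\binom{n}{k}_m^2=\frac{n^2}{2n-1}\sum_{i=1}^m i\big(m(n-1)+i\big)\binom{2n-1}{mn-i}_m.$$
   Context: Let $p_m(t)=1+t+\cdots+t^m$. For integers $N,k\ge 0$, $\binom{N}{k}_m$ is the coefficient of $t^k$ in $p_m(t)^N$ (zero if $k>mN$). -}

module Defs where

open import Data.Nat using (ℕ; zero; suc; _+_; _*_; _∸_; _≤ᵇ_)
open import Data.List using (List; []; _∷_; replicate)
open import Data.Bool using (if_then_else_)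

-- Polynomials with natural coefficients as coefficient lists (lowest degree first).
Poly : Set
Poly = List ℕ

_⊕_ : Poly → Poly → Poly
[] ⊕ q = q
(a ∷ p) ⊕ [] = a ∷ p
(a ∷ p) ⊕ (b ∷ q) = (a + b) ∷ (p ⊕ q)

scale : ℕ → Poly → Poly
scale c [] = []
scale c (a ∷ p) = (c * a) ∷ scale c p

_⊗_ : Poly → Poly → Poly
[] ⊗ q = []
(a ∷ p) ⊗ q = scale a q ⊕ (0 ∷ (p ⊗ q))

pm : ℕ → Poly
pm m = replicate (suc m) 1

_^ₚ_ : Poly → ℕ → Poly
p ^ₚ zero = 1 ∷ []
p ^ₚ suc n = p ⊗ (p ^ₚ n)

coeff : Poly → ℕ → ℕ
coeff [] k = 0
coeff (a ∷ p) zero = a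
coeff (a ∷ p) (suc k) = coeff p k

binomM : ℕ → ℕ → ℕ → ℕ
binomM m N k = coeff (pm m ^ₚ N) k

-- binom(N, a - b)_m for an integer index a - b, which is 0 when a - b < 0
binomMSub : ℕ → ℕ → ℕ → ℕ → ℕ
binomMSub m N a b = if b ≤ᵇ a then binomM m N (a ∸ b) else 0

sumTo : ℕ → (ℕ → ℕ) → ℕ
sumTo zero f = f 0
sumTo (suc n) f = sumTo n f + f (suc n)

sumFrom1 : ℕ → (ℕ → ℕ) → ℕ
sumFrom1 zero f = 0
sumFrom1 (suc n) f = sumFrom1 n f + f (suc n)

{-# OPTIONS --safe #-}
-- Write b_N for the coefficient sequence of p_m(t)^N, so that b_{a+b} = b_a ⋆ b_b (Vandermonde)
-- and b_N is a palindrome on [0, mN]. Then Σ b_n(k)² = (b_n ⋆ b_n)(mn) = b_{2n}(mn), and pairing k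
-- with mn − k gives the first moment. For the second moment, differentiating p^n = p · p^{n−1}
-- gives the Euler identity k b_n(k) = n (θp ⋆ b_{n−1})(k) with θp(i) = i for i ≤ m; substituting
-- it for one factor k b_n(k) and using the palindromy of b_{n−1} turns Σ (k b_n(k))² into
-- n Σ_{i≤m} i (θb_n ⋆ b_{n−1})(m(n−1)+i). Applying the Euler identity once more,
-- (2n−1)(θb_n ⋆ b_{n−1})(s) = n s b_{2n−1}(s), and palindromy of b_{2n−1} finishes the proof.
module Submission where

open import Defs
open import Data.Nat using (ℕ; zero; suc; _+_; _*_; _∸_; _≤_; _<_; _≥_; z≤n; s≤s; _≤ᵇ_)
open import Data.Nat.Properties
open import Data.Nat.Tactic.RingSolver using (solve-∀; solve)
open import Data.Bool using (true)
open import Data.List using (replicate; _∷_; [])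
open import Data.Product using (_×_; _,_)
open import Data.Sum using (inj₁; inj₂)
open import Relation.Binary.PropositionalEquality
open import Algebra.Properties.CommutativeSemigroup +-commutativeSemigroup using (interchange)
open import Algebra.Properties.CommutativeSemigroup *-commutativeSemigroup using (x∙yz≈y∙xz)
open ≡-Reasoning

Seq : Set
Seq = ℕ → ℕ

sumTo-cong : ∀ n {f g : Seq} → (∀ k → k ≤ n → f k ≡ g k) → sumTo n f ≡ sumTo n g
sumTo-cong zero f≡g = f≡g 0 z≤n
sumTo-cong (suc n) f≡g =
  cong₂ _+_ (sumTo-cong n (λ k k≤n → f≡g k (m≤n⇒m≤1+n k≤n))) (f≡g (suc n) ≤-refl)

sumTo-zero : ∀ n {f : Seq} → (∀ k → k ≤ n → f k ≡ 0) → sumTo n f ≡ 0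
sumTo-zero zero f≡0 = f≡0 0 z≤n
sumTo-zero (suc n) f≡0 =
  cong₂ _+_ (sumTo-zero n (λ k k≤n → f≡0 k (m≤n⇒m≤1+n k≤n))) (f≡0 (suc n) ≤-refl)

sumTo-+ : ∀ n (f g : Seq) → sumTo n (λ k → f k + g k) ≡ sumTo n f + sumTo n g
sumTo-+ zero f g = refl
sumTo-+ (suc n) f g = trans (cong (_+ (f (suc n) + g (suc n))) (sumTo-+ n f g))
                            (interchange (sumTo n f) (sumTo n g) (f (suc n)) (g (suc n)))

sumTo-*ˡ : ∀ n c (f : Seq) → sumTo n (λ k → c * f k) ≡ c * sumTo n f
sumTo-*ˡ zero c f = refl
sumTo-*ˡ (suc n) c f = trans (cong (_+ (c * f (suc n))) (sumTo-*ˡ n c f))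
                             (sym (*-distribˡ-+ c (sumTo n f) (f (suc n))))

sumTo-*ʳ : ∀ n c (f : Seq) → sumTo n (λ k → f k * c) ≡ sumTo n f * c
sumTo-*ʳ n c f = begin
  sumTo n (λ k → f k * c) ≡⟨ sumTo-cong n (λ k _ → *-comm (f k) c) ⟩
  sumTo n (λ k → c * f k) ≡⟨ sumTo-*ˡ n c f ⟩
  c * sumTo n f           ≡⟨ *-comm c (sumTo n f) ⟩
  sumTo n f * c           ∎

sumTo-suc : ∀ n (f : Seq) → sumTo (suc n) f ≡ f 0 + sumTo n (λ k → f (suc k))
sumTo-suc zero f = refl
sumTo-suc (suc n) f = trans (cong (_+ f (suc (suc n))) (sumTo-suc n f)) (+-assoc (f 0) _ _)

sumTo-reverse : ∀ n (f : Seq) → sumTo n f ≡ sumTo n (λ k → f (n ∸ k))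
sumTo-reverse zero f = refl
sumTo-reverse (suc n) f = begin
  sumTo (suc n) f                                     ≡⟨ sumTo-suc n f ⟩
  f 0 + sumTo n (λ k → f (suc k))                     ≡⟨ cong (f 0 +_) (sumTo-reverse n (λ k → f (suc k))) ⟩
  f 0 + sumTo n (λ k → f (suc (n ∸ k)))               ≡⟨ +-comm (f 0) _ ⟩
  sumTo n (λ k → f (suc (n ∸ k))) + f 0               ≡⟨ cong₂ _+_ (sumTo-cong n (λ k k≤n → cong f (sym (+-∸-assoc 1 k≤n))))
                                                                   (cong f (sym (n∸n≡0 n))) ⟩
  sumTo (suc n) (λ k → f (suc n ∸ k))                 ∎

sumTo-extend : ∀ n L (f : Seq) → n ≤ L → (∀ k → n < k → k ≤ L → f k ≡ 0) → sumTo L f ≡ sumTo n f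
sumTo-extend n zero f z≤n _ = refl
sumTo-extend n (suc L) f n≤1+L f≡0 with m≤n⇒m<n∨m≡n n≤1+L
... | inj₂ refl = refl
... | inj₁ (s≤s n≤L) = begin
  sumTo L f + f (suc L) ≡⟨ cong (sumTo L f +_) (f≡0 (suc L) (s≤s n≤L) ≤-refl) ⟩
  sumTo L f + 0         ≡⟨ +-identityʳ _ ⟩
  sumTo L f             ≡⟨ sumTo-extend n L f n≤L (λ k n<k k≤L → f≡0 k n<k (m≤n⇒m≤1+n k≤L)) ⟩
  sumTo n f             ∎

sumTo-dropˡ : ∀ j s (f : Seq) → j ≤ s → (∀ k → k < j → f k ≡ 0) → sumTo s f ≡ sumTo (s ∸ j) (λ l → f (j + l))
sumTo-dropˡ zero s f _ _ = refl
sumTo-dropˡ (suc j) (suc s) f (s≤s j≤s) f≡0 = begin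
  sumTo (suc s) f                       ≡⟨ sumTo-suc s f ⟩
  f 0 + sumTo s (λ k → f (suc k))       ≡⟨ cong (_+ sumTo s (λ k → f (suc k))) (f≡0 0 (s≤s z≤n)) ⟩
  sumTo s (λ k → f (suc k))             ≡⟨ sumTo-dropˡ j s (λ k → f (suc k)) j≤s (λ k k<j → f≡0 (suc k) (s≤s k<j)) ⟩
  sumTo (s ∸ j) (λ l → f (suc (j + l))) ∎

sumTo-comm : ∀ a b (F : ℕ → ℕ → ℕ) →
             sumTo a (λ i → sumTo b (λ j → F i j)) ≡ sumTo b (λ j → sumTo a (λ i → F i j))
sumTo-comm zero b F = refl
sumTo-comm (suc a) b F = begin
  sumTo a (λ i → sumTo b (F i)) + sumTo b (F (suc a)) ≡⟨ cong (_+ sumTo b (F (suc a))) (sumTo-comm a b F) ⟩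
  sumTo b (λ j → sumTo a (λ i → F i j)) + sumTo b (F (suc a)) ≡⟨ sym (sumTo-+ b _ _) ⟩
  sumTo b (λ j → sumTo (suc a) (λ i → F i j)) ∎

sumTo≡sumFrom1 : ∀ n (f : Seq) → f 0 ≡ 0 → sumTo n f ≡ sumFrom1 n f
sumTo≡sumFrom1 zero f f0≡0 = f0≡0
sumTo≡sumFrom1 (suc n) f f0≡0 = cong (_+ f (suc n)) (sumTo≡sumFrom1 n f f0≡0)

-- g at the integer index s − j, with value 0 when j > s.
_⟨_−_⟩ : Seq → ℕ → ℕ → ℕ
g ⟨ s − zero ⟩ = g s
g ⟨ zero − suc j ⟩ = 0
g ⟨ suc s − suc j ⟩ = g ⟨ s − j ⟩

data Difference : ℕ → ℕ → Set where
  nonnegative : ∀ j d → Difference (j + d) j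
  negative    : ∀ s e → Difference s (s + suc e)

difference : ∀ s j → Difference s j
difference s zero = nonnegative zero s
difference zero (suc j) = negative zero j
difference (suc s) (suc j) with difference s j
... | nonnegative j d = nonnegative (suc j) d
... | negative s e = negative (suc s) e

⟨−⟩-≤ : ∀ g {s j} → j ≤ s → g ⟨ s − j ⟩ ≡ g (s ∸ j)
⟨−⟩-≤ g z≤n = refl
⟨−⟩-≤ g (s≤s j≤s) = ⟨−⟩-≤ g j≤s

⟨−⟩-> : ∀ g {s j} → s < j → g ⟨ s − j ⟩ ≡ 0
⟨−⟩-> g {zero} {suc j} _ = refl
⟨−⟩-> g {suc s} {suc j} (s≤s s<j) = ⟨−⟩-> g s<j

⟨+−⟩ : ∀ g j d → g ⟨ j + d − j ⟩ ≡ g d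
⟨+−⟩ g zero d = refl
⟨+−⟩ g (suc j) d = ⟨+−⟩ g j d

⟨−+⟩ : ∀ g s e → g ⟨ s − s + suc e ⟩ ≡ 0
⟨−+⟩ g zero e = refl
⟨−+⟩ g (suc s) e = ⟨−+⟩ g s e

VanishesAbove : Seq → ℕ → Set
VanishesAbove f A = ∀ k → A < k → f k ≡ 0

Palindrome : Seq → ℕ → Set
Palindrome f A = ∀ k → k ≤ A → f k ≡ f (A ∸ k)

VanishesAbove-resp : ∀ {f g A} → f ≗ g → VanishesAbove f A → VanishesAbove g A
VanishesAbove-resp f≗g f≡0 k A<k = trans (sym (f≗g k)) (f≡0 k A<k)

Palindrome-resp : ∀ {f g A} → f ≗ g → Palindrome f A → Palindrome g A
Palindrome-resp {A = A} f≗g pal k k≤A = trans (sym (f≗g k)) (trans (pal k k≤A) (f≗g (A ∸ k)))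

-- The integer indices s − j and t − l add up to B; if one of them is negative the other exceeds B.
module _ {g : Seq} {B : ℕ} (g≡0 : VanishesAbove g B) (pal : Palindrome g B) where

  private
    overshoot : ∀ j d t e → j + d + t ≡ B + j + (t + suc e) → g d ≡ 0
    overshoot j d t e eq = g≡0 d (subst (B <_) (sym d≡B+1+e) (m<m+n B (s≤s z≤n)))
      where
      d≡B+1+e : d ≡ B + suc e
      d≡B+1+e = +-cancelˡ-≡ (j + t) d (B + suc e) (begin
        j + t + d               ≡⟨ solve (j ∷ t ∷ d ∷ []) ⟩
        j + d + t               ≡⟨ eq ⟩
        B + j + (t + suc e)     ≡⟨ solve (B ∷ j ∷ t ∷ e ∷ []) ⟩
        j + t + (B + suc e)     ∎)

  palindrome-⟨−⟩ : ∀ s j t l → s + t ≡ B + j + l → g ⟨ s − j ⟩ ≡ g ⟨ t − l ⟩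
  palindrome-⟨−⟩ s j t l eq with difference s j | difference t l
  ... | nonnegative j d | nonnegative l e = begin
    g ⟨ j + d − j ⟩ ≡⟨ ⟨+−⟩ g j d ⟩
    g d             ≡⟨ pal d (subst (d ≤_) d+e≡B (m≤m+n d e)) ⟩
    g (B ∸ d)       ≡⟨ cong g (trans (cong (_∸ d) (sym d+e≡B)) (m+n∸m≡n d e)) ⟩
    g e             ≡⟨ sym (⟨+−⟩ g l e) ⟩
    g ⟨ l + e − l ⟩ ∎
    where
    d+e≡B : d + e ≡ B
    d+e≡B = +-cancelˡ-≡ (j + l) (d + e) B (begin
      j + l + (d + e)   ≡⟨ solve (j ∷ l ∷ d ∷ e ∷ []) ⟩
      j + d + (l + e)   ≡⟨ eq ⟩
      B + j + l         ≡⟨ solve (B ∷ j ∷ l ∷ []) ⟩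
      j + l + B         ∎)
  ... | nonnegative j d | negative t e =
    trans (⟨+−⟩ g j d) (trans (overshoot j d t e eq) (sym (⟨−+⟩ g t e)))
  ... | negative s e | nonnegative l d =
    trans (⟨−+⟩ g s e) (sym (trans (⟨+−⟩ g l d) (overshoot l d s e (trans (+-comm (l + d) s) (trans eq (solve (B ∷ s ∷ e ∷ l ∷ [])))))))
  ... | negative s e | negative t e′ = trans (⟨−+⟩ g s e) (sym (⟨−+⟩ g t e′))

infixl 7 _⋆_
_⋆_ : Seq → Seq → Seq
(f ⋆ g) s = sumTo s (λ j → f j * g (s ∸ j))

δ : Seq
δ zero = 1
δ (suc k) = 0

⋆-cong : ∀ {f f′ g g′} → f ≗ f′ → g ≗ g′ → f ⋆ g ≗ f′ ⋆ g′
⋆-cong f≗f′ g≗g′ s = sumTo-cong s (λ j _ → cong₂ _*_ (f≗f′ j) (g≗g′ (s ∸ j)))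

⋆-congˡ : ∀ {f f′} g → f ≗ f′ → f ⋆ g ≗ f′ ⋆ g
⋆-congˡ {f} {f′} g f≗f′ = ⋆-cong {f} {f′} {g} {g} f≗f′ (λ _ → refl)

⋆-congʳ : ∀ f {g g′} → g ≗ g′ → f ⋆ g ≗ f ⋆ g′
⋆-congʳ f {g} {g′} g≗g′ = ⋆-cong {f} {f} {g} {g′} (λ _ → refl) g≗g′

⋆-comm : ∀ f g → f ⋆ g ≗ g ⋆ f
⋆-comm f g s = trans (sumTo-reverse s _) (sumTo-cong s (λ j j≤s →
  trans (cong (λ i → f (s ∸ j) * g i) (m∸[m∸n]≡n j≤s)) (*-comm (f (s ∸ j)) (g j))))

⋆-identityˡ : ∀ g → δ ⋆ g ≗ g
⋆-identityˡ g zero = +-identityʳ (g 0)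
⋆-identityˡ g (suc s) = begin
  (δ ⋆ g) (suc s)                          ≡⟨ sumTo-suc s _ ⟩
  g (suc s) + 0 + sumTo s (λ _ → 0)        ≡⟨ cong (g (suc s) + 0 +_) (sumTo-zero s (λ _ _ → refl)) ⟩
  g (suc s) + 0 + 0                        ≡⟨ +-identityʳ _ ⟩
  g (suc s) + 0                            ≡⟨ +-identityʳ _ ⟩
  g (suc s)                                ∎

⋆-zeroʳ : ∀ f → f ⋆ (λ _ → 0) ≗ (λ _ → 0)
⋆-zeroʳ f s = sumTo-zero s (λ k _ → *-zeroʳ (f k))

⋆-*ʳ : ∀ f g c → f ⋆ (λ k → c * g k) ≗ (λ s → c * (f ⋆ g) s)
⋆-*ʳ f g c s = trans (sumTo-cong s (λ j _ → x∙yz≈y∙xz (f j) c (g (s ∸ j)))) (sumTo-*ˡ s c _)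

⋆-⟨−⟩ : ∀ f g s → (f ⋆ g) s ≡ sumTo s (λ j → f j * g ⟨ s − j ⟩)
⋆-⟨−⟩ f g s = sumTo-cong s (λ j j≤s → cong (f j *_) (sym (⟨−⟩-≤ g j≤s)))

⋆-⟨−⟩-upTo : ∀ f g {s} L → s ≤ L → (f ⋆ g) s ≡ sumTo L (λ j → f j * g ⟨ s − j ⟩)
⋆-⟨−⟩-upTo f g {s} L s≤L = trans (⋆-⟨−⟩ f g s) (sym (sumTo-extend s L _ s≤L
  (λ k s<k _ → trans (cong (f k *_) (⟨−⟩-> g s<k)) (*-zeroʳ (f k)))))

⋆-⟨−⟩-vanishesAbove : ∀ {f A} g → VanishesAbove f A → ∀ s → (f ⋆ g) s ≡ sumTo A (λ j → f j * g ⟨ s − j ⟩)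
⋆-⟨−⟩-vanishesAbove {f} {A} g f≡0 s with ≤-total s A
... | inj₁ s≤A = ⋆-⟨−⟩-upTo f g A s≤A
... | inj₂ A≤s = trans (⋆-⟨−⟩ f g s)
  (sumTo-extend A s _ A≤s (λ k A<k _ → cong (_* g ⟨ s − k ⟩) (f≡0 k A<k)))

⋆-assoc : ∀ f g h → (f ⋆ g) ⋆ h ≗ f ⋆ (g ⋆ h)
⋆-assoc f g h s = begin
  sumTo s (λ k → (f ⋆ g) k * h (s ∸ k))
    ≡⟨ sumTo-cong s (λ k k≤s → trans (cong (_* h (s ∸ k)) (⋆-⟨−⟩-upTo f g s k≤s)) (sym (sumTo-*ʳ s _ _))) ⟩
  sumTo s (λ k → sumTo s (λ j → f j * g ⟨ k − j ⟩ * h (s ∸ k)))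
    ≡⟨ sumTo-comm s s _ ⟩
  sumTo s (λ j → sumTo s (λ k → f j * g ⟨ k − j ⟩ * h (s ∸ k)))
    ≡⟨ sumTo-cong s inner ⟩
  sumTo s (λ j → f j * (g ⋆ h) (s ∸ j)) ∎
  where
  inner : ∀ j → j ≤ s → sumTo s (λ k → f j * g ⟨ k − j ⟩ * h (s ∸ k)) ≡ f j * (g ⋆ h) (s ∸ j)
  inner j j≤s = begin
    sumTo s (λ k → f j * g ⟨ k − j ⟩ * h (s ∸ k))
      ≡⟨ sumTo-cong s (λ k _ → *-assoc (f j) _ _) ⟩
    sumTo s (λ k → f j * (g ⟨ k − j ⟩ * h (s ∸ k)))
      ≡⟨ sumTo-*ˡ s (f j) _ ⟩
    f j * sumTo s (λ k → g ⟨ k − j ⟩ * h (s ∸ k))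
      ≡⟨ cong (f j *_) (sumTo-dropˡ j s _ j≤s (λ k k<j → cong (_* h (s ∸ k)) (⟨−⟩-> g k<j))) ⟩
    f j * sumTo (s ∸ j) (λ l → g ⟨ j + l − j ⟩ * h (s ∸ (j + l)))
      ≡⟨ cong (f j *_) (sumTo-cong (s ∸ j) (λ l _ → cong₂ _*_ (⟨+−⟩ g j l) (cong h (sym (∸-+-assoc s j l))))) ⟩
    f j * (g ⋆ h) (s ∸ j) ∎

⋆-leftComm : ∀ f g h → f ⋆ (g ⋆ h) ≗ g ⋆ (f ⋆ h)
⋆-leftComm f g h s = begin
  (f ⋆ (g ⋆ h)) s ≡⟨ sym (⋆-assoc f g h s) ⟩
  ((f ⋆ g) ⋆ h) s ≡⟨ ⋆-congˡ h (⋆-comm f g) s ⟩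
  ((g ⋆ f) ⋆ h) s ≡⟨ ⋆-assoc g f h s ⟩
  (g ⋆ (f ⋆ h)) s ∎

⋆-vanishesAbove : ∀ {f g A B} → VanishesAbove f A → VanishesAbove g B → VanishesAbove (f ⋆ g) (A + B)
⋆-vanishesAbove {f} {g} {A} {B} f≡0 g≡0 s A+B<s =
  trans (⋆-⟨−⟩-vanishesAbove g f≡0 s) (sumTo-zero A term≡0)
  where
  term≡0 : ∀ j → j ≤ A → f j * g ⟨ s − j ⟩ ≡ 0
  term≡0 j j≤A with difference s j
  ... | negative s e = trans (cong (f j *_) (⟨−+⟩ g s e)) (*-zeroʳ (f j))
  ... | nonnegative j d = trans (cong (f j *_) (trans (⟨+−⟩ g j d) (g≡0 d B<d))) (*-zeroʳ (f j))
    where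
    B<d : B < d
    B<d = +-cancelˡ-< A B d (<-≤-trans A+B<s (+-monoˡ-≤ d j≤A))

⋆-palindrome : ∀ {f g A B} → VanishesAbove f A → Palindrome f A → VanishesAbove g B → Palindrome g B →
               Palindrome (f ⋆ g) (A + B)
⋆-palindrome {f} {g} {A} {B} f≡0 f-pal g≡0 g-pal s s≤A+B = sym (begin
  (f ⋆ g) s′                                    ≡⟨ ⋆-⟨−⟩-vanishesAbove g f≡0 s′ ⟩
  sumTo A (λ j → f j * g ⟨ s′ − j ⟩)            ≡⟨ sumTo-reverse A _ ⟩
  sumTo A (λ j → f (A ∸ j) * g ⟨ s′ − A ∸ j ⟩)  ≡⟨ sumTo-cong A (λ j j≤A → cong₂ _*_ (sym (f-pal j j≤A))
                                                     (palindrome-⟨−⟩ g≡0 g-pal s′ (A ∸ j) s j (indices j j≤A))) ⟩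
  sumTo A (λ j → f j * g ⟨ s − j ⟩)             ≡⟨ sym (⋆-⟨−⟩-vanishesAbove g f≡0 s) ⟩
  (f ⋆ g) s                                     ∎)
  where
  s′ = A + B ∸ s
  indices : ∀ j → j ≤ A → s′ + s ≡ B + (A ∸ j) + j
  indices j j≤A = begin
    s′ + s              ≡⟨ m∸n+n≡m s≤A+B ⟩
    A + B               ≡⟨ cong (_+ B) (sym (m∸n+n≡m j≤A)) ⟩
    A ∸ j + j + B       ≡⟨ +-comm (A ∸ j + j) B ⟩
    B + (A ∸ j + j)     ≡⟨ sym (+-assoc B (A ∸ j) j) ⟩
    B + (A ∸ j) + j     ∎

coeff-⊕ : ∀ p q → coeff (p ⊕ q) ≗ λ k → coeff p k + coeff q k
coeff-⊕ [] q k = refl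
coeff-⊕ (a ∷ p) [] k = sym (+-identityʳ _)
coeff-⊕ (a ∷ p) (b ∷ q) zero = refl
coeff-⊕ (a ∷ p) (b ∷ q) (suc k) = coeff-⊕ p q k

coeff-scale : ∀ c p → coeff (scale c p) ≗ λ k → c * coeff p k
coeff-scale c [] k = sym (*-zeroʳ c)
coeff-scale c (a ∷ p) zero = refl
coeff-scale c (a ∷ p) (suc k) = coeff-scale c p k

coeff-⊗ : ∀ p q → coeff (p ⊗ q) ≗ coeff p ⋆ coeff q
coeff-⊗ [] q s = sym (sumTo-zero s (λ _ _ → refl))
coeff-⊗ (a ∷ p) q zero =
  trans (coeff-⊕ (scale a q) (0 ∷ (p ⊗ q)) 0) (trans (+-identityʳ _) (coeff-scale a q 0))
coeff-⊗ (a ∷ p) q (suc s) = begin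
  coeff (scale a q ⊕ (0 ∷ (p ⊗ q))) (suc s)        ≡⟨ coeff-⊕ (scale a q) (0 ∷ (p ⊗ q)) (suc s) ⟩
  coeff (scale a q) (suc s) + coeff (p ⊗ q) s      ≡⟨ cong₂ _+_ (coeff-scale a q (suc s)) (coeff-⊗ p q s) ⟩
  a * coeff q (suc s) + (coeff p ⋆ coeff q) s      ≡⟨ sym (sumTo-suc s _) ⟩
  (coeff (a ∷ p) ⋆ coeff q) (suc s)                ∎

-- The Euler operator t·d/dt on coefficient sequences.
θ : Seq → Seq
θ f k = k * f k

θ-⋆ : ∀ f g → θ (f ⋆ g) ≗ λ s → (θ f ⋆ g) s + (f ⋆ θ g) s
θ-⋆ f g s = begin
  s * sumTo s (λ j → f j * g (s ∸ j))
    ≡⟨ sym (sumTo-*ˡ s s _) ⟩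
  sumTo s (λ j → s * (f j * g (s ∸ j)))
    ≡⟨ sumTo-cong s (λ j j≤s → trans (cong (λ i → i * (f j * g (s ∸ j))) (sym (m+[n∸m]≡n j≤s)))
                                     (split j (s ∸ j) (f j) (g (s ∸ j)))) ⟩
  sumTo s (λ j → j * f j * g (s ∸ j) + f j * ((s ∸ j) * g (s ∸ j)))
    ≡⟨ sumTo-+ s _ _ ⟩
  (θ f ⋆ g) s + (f ⋆ θ g) s ∎
  where
  split : ∀ a b x y → (a + b) * (x * y) ≡ a * x * y + x * (b * y)
  split = solve-∀

sumTo-square-palindrome : ∀ {f A} → Palindrome f A → sumTo A (λ k → f k * f k) ≡ (f ⋆ f) A
sumTo-square-palindrome {f} {A} pal = sumTo-cong A (λ k k≤A → cong (f k *_) (pal k k≤A))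

palindrome-first-moment : ∀ {g A} → Palindrome g A → 2 * sumTo A (λ k → k * g k) ≡ A * sumTo A g
palindrome-first-moment {g} {A} pal = begin
  Y + (Y + 0)                                    ≡⟨ cong (Y +_) (+-identityʳ Y) ⟩
  Y + Y                                          ≡⟨ cong (Y +_) Y-reversed ⟩
  Y + sumTo A (λ k → (A ∸ k) * g k)              ≡⟨ sym (sumTo-+ A _ _) ⟩
  sumTo A (λ k → k * g k + (A ∸ k) * g k)        ≡⟨ sumTo-cong A (λ k k≤A → trans (sym (*-distribʳ-+ (g k) k (A ∸ k)))
                                                                                (cong (_* g k) (m+[n∸m]≡n k≤A))) ⟩
  sumTo A (λ k → A * g k)                        ≡⟨ sumTo-*ˡ A A g ⟩
  A * sumTo A g                                  ∎
  where
  Y = sumTo A (λ k → k * g k)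
  Y-reversed : Y ≡ sumTo A (λ k → (A ∸ k) * g k)
  Y-reversed = trans (sumTo-reverse A _) (sumTo-cong A (λ k k≤A → cong ((A ∸ k) *_) (sym (pal k k≤A))))

-- Σ_k x_k (e ⋆ d)_k pairs e_i with the correlation of x against d at lag i; palindromy of d turns
-- that correlation into the convolution x ⋆ d at D + i.
sumTo-*-⋆-palindrome : ∀ {e d A D} L (x : Seq) → VanishesAbove e A → VanishesAbove d D → Palindrome d D →
                       D + A ≤ L → sumTo L (λ k → x k * (e ⋆ d) k) ≡ sumTo A (λ i → e i * (x ⋆ d) (D + i))
sumTo-*-⋆-palindrome {e} {d} {A} {D} L x e≡0 d≡0 d-pal D+A≤L = begin
  sumTo L (λ k → x k * (e ⋆ d) k)
    ≡⟨ sumTo-cong L (λ k _ → expand k) ⟩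
  sumTo L (λ k → sumTo A (λ i → e i * (x k * d ⟨ D + i − k ⟩)))
    ≡⟨ sumTo-comm L A _ ⟩
  sumTo A (λ i → sumTo L (λ k → e i * (x k * d ⟨ D + i − k ⟩)))
    ≡⟨ sumTo-cong A (λ i i≤A → trans (sumTo-*ˡ L (e i) _)
         (cong (e i *_) (sym (⋆-⟨−⟩-upTo x d L (≤-trans (+-monoʳ-≤ D i≤A) D+A≤L))))) ⟩
  sumTo A (λ i → e i * (x ⋆ d) (D + i)) ∎
  where
  expand : ∀ k → x k * (e ⋆ d) k ≡ sumTo A (λ i → e i * (x k * d ⟨ D + i − k ⟩))
  expand k = begin
    x k * (e ⋆ d) k                                 ≡⟨ cong (x k *_) (⋆-⟨−⟩-vanishesAbove d e≡0 k) ⟩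
    x k * sumTo A (λ i → e i * d ⟨ k − i ⟩)         ≡⟨ sym (sumTo-*ˡ A (x k) _) ⟩
    sumTo A (λ i → x k * (e i * d ⟨ k − i ⟩))       ≡⟨ sumTo-cong A (λ i _ → trans (x∙yz≈y∙xz (x k) (e i) _)
         (cong (λ y → e i * (x k * y)) (palindrome-⟨−⟩ d≡0 d-pal k i (D + i) k (+-comm k (D + i))))) ⟩
    sumTo A (λ i → e i * (x k * d ⟨ D + i − k ⟩))   ∎

binomMSub-≤ : ∀ m N {a b} → b ≤ a → binomMSub m N a b ≡ binomM m N (a ∸ b)
binomMSub-≤ m N {a} {b} b≤a with b ≤ᵇ a | ≤⇒≤ᵇ b≤a
... | true | _ = refl

module _ (m : ℕ) where

  pₘ : Seq
  pₘ = coeff (pm m)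

  pₘ-≤ : ∀ {i} → i ≤ m → pₘ i ≡ 1
  pₘ-≤ = go m
    where
    go : ∀ m {i} → i ≤ m → coeff (replicate (suc m) 1) i ≡ 1
    go m z≤n = refl
    go (suc m) (s≤s i≤m) = go m i≤m

  pₘ-vanishesAbove : VanishesAbove pₘ m
  pₘ-vanishesAbove = go m
    where
    go : ∀ m → VanishesAbove (coeff (replicate (suc m) 1)) m
    go zero (suc i) _ = refl
    go (suc m) (suc i) (s≤s m<i) = go m i m<i

  pₘ-palindrome : Palindrome pₘ m
  pₘ-palindrome k k≤m = trans (pₘ-≤ k≤m) (sym (pₘ-≤ (m∸n≤m m k)))

  θpₘ-≤ : ∀ {i} → i ≤ m → θ pₘ i ≡ i
  θpₘ-≤ {i} i≤m = trans (cong (i *_) (pₘ-≤ i≤m)) (*-identityʳ i)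

  θpₘ-vanishesAbove : VanishesAbove (θ pₘ) m
  θpₘ-vanishesAbove k m<k = trans (cong (k *_) (pₘ-vanishesAbove k m<k)) (*-zeroʳ k)

  binomM-zero : binomM m 0 ≗ δ
  binomM-zero zero = refl
  binomM-zero (suc k) = refl

  binomM-suc : ∀ N → binomM m (suc N) ≗ pₘ ⋆ binomM m N
  binomM-suc N = coeff-⊗ (pm m) (pm m ^ₚ N)

  binomM-vanishesAbove : ∀ N → VanishesAbove (binomM m N) (m * N)
  binomM-vanishesAbove zero k 0<k = trans (binomM-zero k) (δ-vanishes k 0<k)
    where
    δ-vanishes : ∀ k → m * 0 < k → δ k ≡ 0
    δ-vanishes (suc k) _ = refl
  binomM-vanishesAbove (suc N) = subst (VanishesAbove (binomM m (suc N))) (sym (*-suc m N))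
    (VanishesAbove-resp (λ k → sym (binomM-suc N k)) (⋆-vanishesAbove pₘ-vanishesAbove (binomM-vanishesAbove N)))

  binomM-palindrome : ∀ N → Palindrome (binomM m N) (m * N)
  binomM-palindrome zero = subst (Palindrome (binomM m 0)) (sym (*-zeroʳ m)) palindrome-at-0
    where
    palindrome-at-0 : Palindrome (binomM m 0) 0
    palindrome-at-0 zero _ = refl
  binomM-palindrome (suc N) = subst (Palindrome (binomM m (suc N))) (sym (*-suc m N))
    (Palindrome-resp (λ k → sym (binomM-suc N k))
      (⋆-palindrome pₘ-vanishesAbove pₘ-palindrome (binomM-vanishesAbove N) (binomM-palindrome N)))

  binomM-+ : ∀ a b → binomM m (a + b) ≗ binomM m a ⋆ binomM m b
  binomM-+ zero b k = trans (sym (⋆-identityˡ (binomM m b) k)) (⋆-congˡ (binomM m b) (λ j → sym (binomM-zero j)) k)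
  binomM-+ (suc a) b k = begin
    binomM m (suc (a + b)) k                      ≡⟨ binomM-suc (a + b) k ⟩
    (pₘ ⋆ binomM m (a + b)) k                     ≡⟨ ⋆-congʳ pₘ (binomM-+ a b) k ⟩
    (pₘ ⋆ (binomM m a ⋆ binomM m b)) k            ≡⟨ sym (⋆-assoc pₘ (binomM m a) (binomM m b) k) ⟩
    (pₘ ⋆ binomM m a ⋆ binomM m b) k              ≡⟨ ⋆-congˡ (binomM m b) (λ j → sym (binomM-suc a j)) k ⟩
    (binomM m (suc a) ⋆ binomM m b) k             ∎

  θ-binomM-suc : ∀ N → θ (binomM m (suc N)) ≗ λ k → suc N * (θ pₘ ⋆ binomM m N) k
  θ-binomM-suc N k = begin
    θ (binomM m (suc N)) k                                   ≡⟨ cong (k *_) (binomM-suc N k) ⟩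
    θ (pₘ ⋆ binomM m N) k                                    ≡⟨ θ-⋆ pₘ (binomM m N) k ⟩
    (θ pₘ ⋆ binomM m N) k + (pₘ ⋆ θ (binomM m N)) k          ≡⟨ cong ((θ pₘ ⋆ binomM m N) k +_) (pₘ-⋆-θ-binomM N) ⟩
    (θ pₘ ⋆ binomM m N) k + N * (θ pₘ ⋆ binomM m N) k        ∎
    where
    pₘ-⋆-θ-binomM : ∀ N → (pₘ ⋆ θ (binomM m N)) k ≡ N * (θ pₘ ⋆ binomM m N) k
    pₘ-⋆-θ-binomM zero = trans (⋆-congʳ pₘ θ-binomM-zero k) (⋆-zeroʳ pₘ k)
      where
      θ-binomM-zero : θ (binomM m 0) ≗ λ _ → 0
      θ-binomM-zero zero = refl
      θ-binomM-zero (suc j) = *-zeroʳ (suc j)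
    pₘ-⋆-θ-binomM (suc N) = begin
      (pₘ ⋆ θ (binomM m (suc N))) k                        ≡⟨ ⋆-congʳ pₘ (θ-binomM-suc N) k ⟩
      (pₘ ⋆ (λ j → suc N * (θ pₘ ⋆ binomM m N) j)) k       ≡⟨ ⋆-*ʳ pₘ (θ pₘ ⋆ binomM m N) (suc N) k ⟩
      suc N * (pₘ ⋆ (θ pₘ ⋆ binomM m N)) k                 ≡⟨ cong (suc N *_) (⋆-leftComm pₘ (θ pₘ) (binomM m N) k) ⟩
      suc N * (θ pₘ ⋆ (pₘ ⋆ binomM m N)) k                 ≡⟨ cong (suc N *_) (⋆-congʳ (θ pₘ) (λ j → sym (binomM-suc N j)) k) ⟩
      suc N * (θ pₘ ⋆ binomM m (suc N)) k                  ∎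

sumTo-binomM² : ∀ m n → sumTo (m * n) (λ k → binomM m n k * binomM m n k) ≡ binomM m (2 * n) (m * n)
sumTo-binomM² m n = begin
  sumTo (m * n) (λ k → binomM m n k * binomM m n k) ≡⟨ sumTo-square-palindrome (binomM-palindrome m n) ⟩
  (binomM m n ⋆ binomM m n) (m * n)                 ≡⟨ sym (binomM-+ m n n (m * n)) ⟩
  binomM m (n + n) (m * n)                          ≡⟨ cong (λ N → binomM m (n + N) (m * n)) (sym (+-identityʳ n)) ⟩
  binomM m (2 * n) (m * n)                          ∎

sumTo-id*binomM² : ∀ m n → 2 * sumTo (m * n) (λ k → k * (binomM m n k * binomM m n k))
                           ≡ (m * n) * binomM m (2 * n) (m * n)
sumTo-id*binomM² m n = trans (palindrome-first-moment squares-palindrome) (cong ((m * n) *_) (sumTo-binomM² m n))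
  where
  squares-palindrome : Palindrome (λ k → binomM m n k * binomM m n k) (m * n)
  squares-palindrome k k≤mn = cong₂ _*_ (binomM-palindrome m n k k≤mn) (binomM-palindrome m n k k≤mn)

2*[1+n]∸1≡1+[n+n] : ∀ n → 2 * suc n ∸ 1 ≡ suc (n + n)
2*[1+n]∸1≡1+[n+n] n = trans (+-suc n (n + 0)) (cong (λ x → suc (n + x)) (+-identityʳ n))

module _ (m n′ : ℕ) where

  θbinomM-⋆-binomM : ∀ s → suc (n′ + n′) * (θ (binomM m (suc n′)) ⋆ binomM m n′) s
                           ≡ suc n′ * (s * binomM m (suc (n′ + n′)) s)
  θbinomM-⋆-binomM s = begin
    N * (θ a ⋆ d) s                        ≡⟨ cong (N *_) (⋆-comm (θ a) d s) ⟩
    N * (d ⋆ θ a) s                        ≡⟨ cong (N *_) (⋆-congʳ d (θ-binomM-suc m n′) s) ⟩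
    N * (d ⋆ (λ j → n * (θp ⋆ d) j)) s     ≡⟨ cong (N *_) (⋆-*ʳ d (θp ⋆ d) n s) ⟩
    N * (n * (d ⋆ (θp ⋆ d)) s)             ≡⟨ cong (λ y → N * (n * y)) (⋆-leftComm d θp d s) ⟩
    N * (n * (θp ⋆ (d ⋆ d)) s)             ≡⟨ cong (λ y → N * (n * y)) (⋆-congʳ θp (λ j → sym (binomM-+ m n′ n′ j)) s) ⟩
    N * (n * (θp ⋆ binomM m (n′ + n′)) s)  ≡⟨ x∙yz≈y∙xz N n _ ⟩
    n * (N * (θp ⋆ binomM m (n′ + n′)) s)  ≡⟨ cong (n *_) (sym (θ-binomM-suc m (n′ + n′) s)) ⟩
    n * (s * binomM m N s)                 ∎
    where
    n = suc n′
    N = suc (n′ + n′)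
    a = binomM m n
    d = binomM m n′
    θp = θ (pₘ m)

  sumTo-square*binomM²-correlation :
    sumTo (m * suc n′) (λ k → (k * k) * (binomM m (suc n′) k * binomM m (suc n′) k))
    ≡ suc n′ * sumTo m (λ i → θ (pₘ m) i * (θ (binomM m (suc n′)) ⋆ binomM m n′) (m * n′ + i))
  sumTo-square*binomM²-correlation = begin
    sumTo B (λ k → (k * k) * (a k * a k))            ≡⟨ sumTo-cong B (λ k _ → square-split k) ⟩
    sumTo B (λ k → n * (θ a k * (θp ⋆ d) k))         ≡⟨ sumTo-*ˡ B n _ ⟩
    n * sumTo B (λ k → θ a k * (θp ⋆ d) k)           ≡⟨ cong (n *_) (sumTo-*-⋆-palindrome B (θ a)
                                                          (θpₘ-vanishesAbove m) (binomM-vanishesAbove m n′)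
                                                          (binomM-palindrome m n′) (≤-reflexive B′+m≡B)) ⟩
    n * sumTo m (λ i → θp i * (θ a ⋆ d) (B′ + i))    ∎
    where
    n = suc n′
    B = m * n
    B′ = m * n′
    a = binomM m n
    d = binomM m n′
    θp = θ (pₘ m)
    B′+m≡B : B′ + m ≡ B
    B′+m≡B = trans (+-comm B′ m) (sym (*-suc m n′))
    rearrange : ∀ k x → (k * k) * (x * x) ≡ (k * x) * (k * x)
    rearrange = solve-∀
    square-split : ∀ k → (k * k) * (a k * a k) ≡ n * (θ a k * (θp ⋆ d) k)
    square-split k = begin
      (k * k) * (a k * a k)           ≡⟨ rearrange k (a k) ⟩
      θ a k * θ a k                   ≡⟨ cong (θ a k *_) (θ-binomM-suc m n′ k) ⟩
      θ a k * (n * (θp ⋆ d) k)        ≡⟨ x∙yz≈y∙xz (θ a k) n _ ⟩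
      n * (θ a k * (θp ⋆ d) k)        ∎

  binomM-odd≡binomMSub : ∀ {i} → i ≤ m →
                         binomM m (suc (n′ + n′)) (m * n′ + i) ≡ binomMSub m (2 * suc n′ ∸ 1) (m * suc n′) i
  binomM-odd≡binomMSub {i} i≤m = begin
    binomM m N (B′ + i)                         ≡⟨ binomM-palindrome m N (B′ + i) (≤-trans B′+i≤B B≤mN) ⟩
    binomM m N (m * N ∸ (B′ + i))               ≡⟨ cong (binomM m N) mN∸[B′+i]≡B∸i ⟩
    binomM m N (B ∸ i)                          ≡⟨ cong (λ M → binomM m M (B ∸ i)) (sym (2*[1+n]∸1≡1+[n+n] n′)) ⟩
    binomM m (2 * suc n′ ∸ 1) (B ∸ i)           ≡⟨ sym (binomMSub-≤ m (2 * suc n′ ∸ 1) i≤B) ⟩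
    binomMSub m (2 * suc n′ ∸ 1) B i            ∎
    where
    N = suc (n′ + n′)
    B = m * suc n′
    B′ = m * n′
    B≡B′+m : B ≡ B′ + m
    B≡B′+m = trans (*-suc m n′) (+-comm m B′)
    B′+i≤B : B′ + i ≤ B
    B′+i≤B = subst (B′ + i ≤_) (sym B≡B′+m) (+-monoʳ-≤ B′ i≤m)
    i≤B : i ≤ B
    i≤B = ≤-trans (m≤n+m i B′) B′+i≤B
    mN≡B′+B : m * N ≡ B′ + B
    mN≡B′+B = trans (*-distribˡ-+ m (suc n′) n′) (+-comm B B′)
    B≤mN : B ≤ m * N
    B≤mN = subst (B ≤_) (sym mN≡B′+B) (m≤n+m B B′)
    mN∸[B′+i]≡B∸i : m * N ∸ (B′ + i) ≡ B ∸ i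
    mN∸[B′+i]≡B∸i = trans (cong (_∸ (B′ + i)) mN≡B′+B) ([m+n]∸[m+o]≡n∸o B′ B i)

  sumTo-square*binomM² :
    (2 * suc n′ ∸ 1) * sumTo (m * suc n′) (λ k → (k * k) * (binomM m (suc n′) k * binomM m (suc n′) k))
    ≡ (suc n′ * suc n′) * sumFrom1 m (λ i → i * (m * n′ + i) * binomMSub m (2 * suc n′ ∸ 1) (m * suc n′) i)
  sumTo-square*binomM² = begin
    (2 * n ∸ 1) * sumTo B (λ k → (k * k) * (a k * a k))   ≡⟨ cong₂ _*_ (2*[1+n]∸1≡1+[n+n] n′) sumTo-square*binomM²-correlation ⟩
    N * (n * sumTo m (λ i → θp i * C i))                  ≡⟨ x∙yz≈y∙xz N n _ ⟩
    n * (N * sumTo m (λ i → θp i * C i))                  ≡⟨ cong (n *_) (sym (sumTo-*ˡ m N _)) ⟩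
    n * sumTo m (λ i → N * (θp i * C i))                  ≡⟨ cong (n *_) (sumTo-cong m term) ⟩
    n * sumTo m (λ i → n * F i)                           ≡⟨ cong (n *_) (sumTo-*ˡ m n F) ⟩
    n * (n * sumTo m F)                                   ≡⟨ sym (*-assoc n n _) ⟩
    n * n * sumTo m F                                     ≡⟨ cong (n * n *_) (sumTo≡sumFrom1 m F refl) ⟩
    n * n * sumFrom1 m F                                  ∎
    where
    n = suc n′
    N = suc (n′ + n′)
    B = m * n
    B′ = m * n′
    a = binomM m n
    θp = θ (pₘ m)
    C : ℕ → ℕ
    C i = (θ a ⋆ binomM m n′) (B′ + i)
    F : ℕ → ℕ
    F i = i * (B′ + i) * binomMSub m (2 * n ∸ 1) B i
    rearrange : ∀ i n x y → i * (n * (x * y)) ≡ n * (i * x * y)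
    rearrange = solve-∀
    term : ∀ i → i ≤ m → N * (θp i * C i) ≡ n * F i
    term i i≤m = begin
      N * (θp i * C i)                                 ≡⟨ x∙yz≈y∙xz N (θp i) (C i) ⟩
      θp i * (N * C i)                                 ≡⟨ cong₂ _*_ (θpₘ-≤ m i≤m) (θbinomM-⋆-binomM (B′ + i)) ⟩
      i * (n * ((B′ + i) * binomM m N (B′ + i)))       ≡⟨ rearrange i n (B′ + i) _ ⟩
      n * (i * (B′ + i) * binomM m N (B′ + i))         ≡⟨ cong (λ y → n * (i * (B′ + i) * y)) (binomM-odd≡binomMSub i≤m) ⟩
      n * F i                                          ∎

mainTheorem10 : (m : ℕ) → m ≥ 1 → (n : ℕ) →
    (sumTo (m * n) (λ k → binomM m n k * binomM m n k) ≡ binomM m (2 * n) (m * n))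
    × (2 * sumTo (m * n) (λ k → k * (binomM m n k * binomM m n k))
        ≡ (m * n) * binomM m (2 * n) (m * n))
    × ((2 * n ∸ 1) * sumTo (m * n) (λ k → (k * k) * (binomM m n k * binomM m n k))
        ≡ (n * n) * sumFrom1 m (λ i → i * (m * (n ∸ 1) + i) * binomMSub m (2 * n ∸ 1) (m * n) i))
-- The identities also hold for m = 0 (then p₀ = 1).
mainTheorem10 m _ n = sumTo-binomM² m n , sumTo-id*binomM² m n , second-moment n
  where
  second-moment : ∀ n → (2 * n ∸ 1) * sumTo (m * n) (λ k → (k * k) * (binomM m n k * binomM m n k))
                      ≡ (n * n) * sumFrom1 m (λ i → i * (m * (n ∸ 1) + i) * binomMSub m (2 * n ∸ 1) (m * n) i)
  second-moment zero = refl
  second-moment (suc n′) = sumTo-square*binomM² m n′
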